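{- The rainbow-free minimal colorings of $[3]^2$ with exactly 4 colors are precisely the colorings in $S_1\cup S_2$, where $S_1$ consists of those minimal 4-colorings whose three non-dominant points form $\{(1,2),(2,3),(3,1)\}$ or $\{(1,3),(2,1),(3,2)\}$, and $S_2$ consists of those whose three non-dominant points form $\{(1,1),(2,3),(3,2)\}$, $\{(2,2),(1,3),(3,1)\}$ or $\{(3,3),(1,2),(2,1)\}$.
   Context: $[3]^2$ is the set of pairs $(x_1,x_2)$ with $x_i\in\{1,2,3\}$. A combinatorial line is determined by a word $w\in(\{1,2,3\}\cup\{*\})^2$ containing at least one $*$; it consists of the 3 points obtained by replacing every $*$ by $1$, $2$, $3$ respectively (so the lines are the 3 rows, 3 columns and the diagonal $\{(1,1),(2,2),(3,3)\}$). A line is rainbow if its 3 points receive 3 pairwise different colors; a coloring is rainbow-free if no line is rainbow. A coloring is minimal if all colors but one (the dominant color) appear on exactly one point; the points of non-dominant colors are called non-dominant points. -}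

module Defs where

open import Data.Fin using (Fin; zero; suc)
open import Data.Maybe using (Maybe; just; nothing)
open import Data.Product using (_×_; _,_; ∃; ∃-syntax; Σ)
open import Data.Sum using (_⊎_)
open import Data.List using (List; []; _∷_)
open import Data.List.Membership.Propositional using (_∈_)
open import Relation.Binary.PropositionalEquality using (_≡_; _≢_)
open import Relation.Nullary using (¬_)
open import Function.Bundles using (_⇔_)

-- [3] = {1,2,3} is encoded by Fin 3 with 1 ↦ zero, 2 ↦ suc zero, 3 ↦ suc (suc zero).
Point : Set
Point = Fin 3 × Fin 3

i1 i2 i3 : Fin 3
i1 = zero
i2 = suc zero
i3 = suc (suc zero)

Coloring : Set → Set
Coloring C = Point → C

-- Words over {1,2,3} ∪ {*} of length 2; nothing = *.
Word : Set
Word = Maybe (Fin 3) × Maybe (Fin 3)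

HasStar : Word → Set
HasStar (a , b) = (a ≡ nothing) ⊎ (b ≡ nothing)

subst* : Maybe (Fin 3) → Fin 3 → Fin 3
subst* nothing  i = i
subst* (just a) i = a

inst : Word → Fin 3 → Point
inst (a , b) i = subst* a i , subst* b i

Rainbow : {C : Set} → Coloring C → Word → Set
Rainbow c w =
  (c (inst w i1) ≢ c (inst w i2)) ×
  (c (inst w i1) ≢ c (inst w i3)) ×
  (c (inst w i2) ≢ c (inst w i3))

RainbowFree : {C : Set} → Coloring C → Set
RainbowFree c = (w : Word) → HasStar w → ¬ Rainbow c w

UsesAllColors : {C : Set} → Coloring C → Set
UsesAllColors {C} c = (k : C) → ∃[ p ] c p ≡ k

ExactlyOnce : {C : Set} → Coloring C → C → Set
ExactlyOnce c k = ∃[ p ] ((c p ≡ k) × ((q : Point) → c q ≡ k → q ≡ p))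

IsDominant : {C : Set} → Coloring C → C → Set
IsDominant {C} c d = (k : C) → k ≢ d → ExactlyOnce c k

Minimal : {C : Set} → Coloring C → Set
Minimal c = ∃[ d ] IsDominant c d

NonDominantSetIs : {C : Set} → Coloring C → C → List Point → Set
NonDominantSetIs c d T = (p : Point) → (c p ≢ d) ⇔ (p ∈ T)

MinimalWithNonDom : {C : Set} → Coloring C → List Point → Set
MinimalWithNonDom c T = ∃[ d ] (IsDominant c d × NonDominantSetIs c d T)

T1a T1b T2a T2b T2c : List Point
T1a = (i1 , i2) ∷ (i2 , i3) ∷ (i3 , i1) ∷ []
T1b = (i1 , i3) ∷ (i2 , i1) ∷ (i3 , i2) ∷ []
T2a = (i1 , i1) ∷ (i2 , i3) ∷ (i3 , i2) ∷ []
T2b = (i2 , i2) ∷ (i1 , i3) ∷ (i3 , i1) ∷ []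
T2c = (i3 , i3) ∷ (i1 , i2) ∷ (i2 , i1) ∷ []

InS1 : {C : Set} → Coloring C → Set
InS1 c = MinimalWithNonDom c T1a ⊎ MinimalWithNonDom c T1b

InS2 : {C : Set} → Coloring C → Set
InS2 c = MinimalWithNonDom c T2a ⊎ MinimalWithNonDom c T2b ⊎ MinimalWithNonDom c T2c

-- With a dominant colour d, a colour other than d sits on a single point, so a line is
-- rainbow exactly when at least two of its three points are non-dominant. Hence a minimal
-- colouring is rainbow-free iff its set T of non-dominant points meets every line at most
-- once. With 4 colours T has 3 points, one per row and one per column, i.e. T is a
-- permutation matrix; avoiding the diagonal leaves the two 3-cycles (S₁) and the three
-- transpositions (S₂).
module Submission where

open import Defs
open import Data.Nat using (ℕ)
open import Data.Fin using (Fin; punchIn; punchOut)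
open import Data.Fin.Properties
  using (all?; punchInᵢ≢i; punchIn-punchOut; punchIn-injective) renaming (_≟_ to _≟ᶠ_)
open import Data.Maybe using (Maybe; just; nothing)
import Data.Maybe.Properties as Maybe
open import Data.Product using (_×_; _,_; proj₁; proj₂; ∃-syntax) renaming (map to ×-map)
open import Data.Product.Properties using () renaming (≡-dec to ×-≡-dec)
open import Data.Sum using (_⊎_; inj₁; inj₂)
import Data.Sum as Sum
open import Data.Unit using (tt)
open import Data.List using (List; []; _∷_; tabulate)
open import Data.List.Membership.Propositional using (_∈_; _∉_)
open import Data.List.Membership.Propositional.Properties using (∈-tabulate⁺; ∈-tabulate⁻)
open import Data.List.Relation.Binary.Subset.Propositional using (_⊆_)
open import Function using (_∘_)
open import Level using (0ℓ)
open import Function.Bundles using (_⇔_; mk⇔; Equivalence)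
open import Relation.Binary.Definitions using (DecidableEquality)
open import Relation.Binary.PropositionalEquality
  using (_≡_; _≢_; refl; sym; trans; cong; subst; ≢-sym)
open import Relation.Nullary using (¬_; Dec; yes; no; contradiction)
open import Relation.Nullary.Decidable
  using (True; toWitness; map′; _×-dec_; _⊎-dec_; _→-dec_; ¬?)
open import Relation.Unary using (Pred; Decidable)

_≟ₚ_ : DecidableEquality Point
_≟ₚ_ = ×-≡-dec _≟ᶠ_ _≟ᶠ_

open import Data.List.Membership.DecPropositional _≟ₚ_ using (_∈?_)
open import Data.List.Relation.Binary.Subset.DecPropositional _≟ₚ_ using (_⊆?_)
open import Data.List.Relation.Unary.Unique.DecPropositional _≟ₚ_ using (Unique; unique?)
open import Data.List.Relation.Unary.Unique.Propositional.Properties using (tabulate⁺)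

AtLeastTwoPoints : Pred Point 0ℓ → Word → Set
AtLeastTwoPoints P w =
  (P (inst w i1) × P (inst w i2)) ⊎
  (P (inst w i1) × P (inst w i3)) ⊎
  (P (inst w i2) × P (inst w i3))

atLeastTwoPoints-map : ∀ {P Q : Pred Point 0ℓ} → (∀ p → P p → Q p) →
                       ∀ w → AtLeastTwoPoints P w → AtLeastTwoPoints Q w
atLeastTwoPoints-map f _ =
  Sum.map (×-map (f _) (f _)) (Sum.map (×-map (f _) (f _)) (×-map (f _) (f _)))

atLeastTwoPoints-dichotomy : ∀ {P : Pred Point 0ℓ} → Decidable P →
                             ∀ w → AtLeastTwoPoints P w ⊎ AtLeastTwoPoints (¬_ ∘ P) w
atLeastTwoPoints-dichotomy P? w with P? (inst w i1) | P? (inst w i2) | P? (inst w i3)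
... | yes p₁ | yes p₂ | _      = inj₁ (inj₁ (p₁ , p₂))
... | yes p₁ | no ¬p₂ | yes p₃ = inj₁ (inj₂ (inj₁ (p₁ , p₃)))
... | yes _  | no ¬p₂ | no ¬p₃ = inj₂ (inj₂ (inj₂ (¬p₂ , ¬p₃)))
... | no ¬p₁ | yes p₂ | yes p₃ = inj₁ (inj₂ (inj₂ (p₂ , p₃)))
... | no ¬p₁ | yes _  | no ¬p₃ = inj₂ (inj₂ (inj₁ (¬p₁ , ¬p₃)))
... | no ¬p₁ | no ¬p₂ | _      = inj₂ (inj₁ (¬p₁ , ¬p₂))

inst-injective : ∀ {w} → HasStar w → ∀ {i j} → inst w i ≡ inst w j → i ≡ j
inst-injective {nothing , _} (inj₁ refl) = cong proj₁
inst-injective {_ , nothing} (inj₂ refl) = cong proj₂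

module _ {C : Set} {c : Coloring C} {d : C} where

  nonDominant-colour-unique : IsDominant c d → ∀ {p q} → c p ≢ d → p ≢ q → c p ≢ c q
  nonDominant-colour-unique dom {p} {q} cp≢d p≢q cp≡cq with dom (c p) cp≢d
  ... | _ , _ , unique = p≢q (trans (unique p refl) (sym (unique q (sym cp≡cq))))

  twoDominant⇒¬rainbow : ∀ w → AtLeastTwoPoints (λ p → c p ≡ d) w → ¬ Rainbow c w
  twoDominant⇒¬rainbow _ (inj₁ (e₁ , e₂))        (r₁₂ , _ , _) = r₁₂ (trans e₁ (sym e₂))
  twoDominant⇒¬rainbow _ (inj₂ (inj₁ (e₁ , e₃))) (_ , r₁₃ , _) = r₁₃ (trans e₁ (sym e₃))
  twoDominant⇒¬rainbow _ (inj₂ (inj₂ (e₂ , e₃))) (_ , _ , r₂₃) = r₂₃ (trans e₂ (sym e₃))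

  twoNonDominant⇒rainbow : IsDominant c d → ∀ w → HasStar w →
                           AtLeastTwoPoints (λ p → c p ≢ d) w → Rainbow c w
  twoNonDominant⇒rainbow dom w star = λ
    { (inj₁ (n₁ , n₂))        → unique n₁ 1≢2 , unique n₁ 1≢3 , unique n₂ 2≢3
    ; (inj₂ (inj₁ (n₁ , n₃))) → unique n₁ 1≢2 , unique n₁ 1≢3 , ≢-sym (unique n₃ (≢-sym 2≢3))
    ; (inj₂ (inj₂ (n₂ , n₃))) →
        ≢-sym (unique n₂ (≢-sym 1≢2)) , ≢-sym (unique n₃ (≢-sym 1≢3)) , unique n₂ 2≢3
    }
    where
    unique = nonDominant-colour-unique dom
    distinct : ∀ {i j} → i ≢ j → inst w i ≢ inst w j
    distinct i≢j = i≢j ∘ inst-injective star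
    1≢2 = distinct {i1} {i2} λ ()
    1≢3 = distinct {i1} {i3} λ ()
    2≢3 = distinct {i2} {i3} λ ()

Sparse : List Point → Set
Sparse T = ∀ w → HasStar w → AtLeastTwoPoints (_∉ T) w

module _ {C : Set} (_≟_ : DecidableEquality C) {c : Coloring C} {d : C} {T : List Point}
         (nonDom : NonDominantSetIs c d T) where

  private
    dominant⇒∉ : ∀ p → c p ≡ d → p ∉ T
    dominant⇒∉ p cp≡d p∈T = Equivalence.from (nonDom p) p∈T cp≡d

    ∉⇒dominant : ∀ p → p ∉ T → c p ≡ d
    ∉⇒dominant p p∉T with c p ≟ d
    ... | yes cp≡d = cp≡d
    ... | no cp≢d  = contradiction (Equivalence.to (nonDom p) cp≢d) p∉T

  rainbowFree⇒sparse : IsDominant c d → RainbowFree c → Sparse T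
  rainbowFree⇒sparse dom rf w star with atLeastTwoPoints-dichotomy (λ p → c p ≟ d) w
  ... | inj₁ twoDominant    = atLeastTwoPoints-map dominant⇒∉ w twoDominant
  ... | inj₂ twoNonDominant =
    contradiction (twoNonDominant⇒rainbow dom w star twoNonDominant) (rf w star)

  sparse⇒rainbowFree : Sparse T → RainbowFree c
  sparse⇒rainbowFree sparse w star =
    twoDominant⇒¬rainbow {c = c} w (atLeastTwoPoints-map ∉⇒dominant w (sparse w star))

module _ {n} {c : Coloring (Fin (ℕ.suc n))} {d} (dom : IsDominant c d) where

  nonDominantSetIs-tabulate : (p : Fin n → Point) → (∀ j → c (p j) ≡ punchIn d j) →
                              NonDominantSetIs c d (tabulate p)
  nonDominantSetIs-tabulate p colour-p q = mk⇔ nonDominant⇒∈ ∈⇒nonDominant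
    where
    nonDominant⇒∈ : c q ≢ d → q ∈ tabulate p
    nonDominant⇒∈ cq≢d with dom (c q) cq≢d
    ... | _ , _ , unique = subst (_∈ tabulate p) (sym q≡pj) (∈-tabulate⁺ j)
      where
      j = punchOut (≢-sym cq≢d)
      q≡pj = trans (unique q refl)
                   (sym (unique (p j) (trans (colour-p j) (punchIn-punchOut _))))

    ∈⇒nonDominant : q ∈ tabulate p → c q ≢ d
    ∈⇒nonDominant q∈ with ∈-tabulate⁻ q∈
    ... | j , refl = subst (_≢ d) (sym (colour-p j)) (punchInᵢ≢i d j)

  nonDominantSet-enumeration : UsesAllColors c →
                               ∃[ p ] Unique (tabulate p) × NonDominantSetIs c d (tabulate p)
  nonDominantSet-enumeration usesAll =
    p , tabulate⁺ p-injective , nonDominantSetIs-tabulate p colour-p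
    where
    p : Fin n → Point
    p j = proj₁ (usesAll (punchIn d j))
    colour-p : ∀ j → c (p j) ≡ punchIn d j
    colour-p j = proj₂ (usesAll (punchIn d j))
    p-injective : ∀ {i j} → p i ≡ p j → i ≡ j
    p-injective {i} {j} pi≡pj =
      punchIn-injective d i j (trans (sym (colour-p i)) (trans (cong c pi≡pj) (colour-p j)))

SameElements : List Point → List Point → Set
SameElements L T = L ⊆ T × T ⊆ L

nonDominantSetIs-resp-sameElements : ∀ {C : Set} {c : Coloring C} {d L T} →
                                     NonDominantSetIs c d L → SameElements L T →
                                     NonDominantSetIs c d T
nonDominantSetIs-resp-sameElements nonDom (L⊆T , T⊆L) p =
  mk⇔ (L⊆T ∘ Equivalence.to (nonDom p)) (Equivalence.from (nonDom p) ∘ T⊆L)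

∀-×? : ∀ {A B : Set} →
       (∀ {Q : Pred A 0ℓ} → Decidable Q → Dec (∀ a → Q a)) →
       (∀ {Q : Pred B 0ℓ} → Decidable Q → Dec (∀ b → Q b)) →
       ∀ {P : Pred (A × B) 0ℓ} → Decidable P → Dec (∀ ab → P ab)
∀-×? ∀A? ∀B? P? =
  map′ (λ f (a , b) → f a b) (λ f a b → f (a , b)) (∀A? λ a → ∀B? λ b → P? (a , b))

∀-Maybe? : ∀ {n} {P : Pred (Maybe (Fin n)) 0ℓ} → Decidable P → Dec (∀ m → P m)
∀-Maybe? P? = map′ (λ { (pn , _) nothing → pn ; (_ , pj) (just i) → pj i })
                   (λ f → f nothing , f ∘ just)
                   (P? nothing ×-dec all? (P? ∘ just))

∀-Point? : ∀ {P : Pred Point 0ℓ} → Decidable P → Dec (∀ p → P p)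
∀-Point? = ∀-×? all? all?

∀-Word? : ∀ {P : Pred Word 0ℓ} → Decidable P → Dec (∀ w → P w)
∀-Word? = ∀-×? ∀-Maybe? ∀-Maybe?

hasStar? : Decidable HasStar
hasStar? (a , b) = (a ≟ₘ nothing) ⊎-dec (b ≟ₘ nothing)
  where _≟ₘ_ = Maybe.≡-dec _≟ᶠ_

atLeastTwoPoints? : ∀ {P : Pred Point 0ℓ} → Decidable P → Decidable (AtLeastTwoPoints P)
atLeastTwoPoints? P? w =
  (P? (inst w i1) ×-dec P? (inst w i2)) ⊎-dec
  (P? (inst w i1) ×-dec P? (inst w i3)) ⊎-dec
  (P? (inst w i2) ×-dec P? (inst w i3))

sparse? : Decidable Sparse
sparse? T = ∀-Word? λ w → hasStar? w →-dec atLeastTwoPoints? (λ p → ¬? (p ∈? T)) w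

AnyCandidate : Pred (List Point) 0ℓ → Set
AnyCandidate P = (P T1a ⊎ P T1b) ⊎ (P T2a ⊎ P T2b ⊎ P T2c)

anyCandidate? : ∀ {P : Pred (List Point) 0ℓ} → Decidable P → Dec (AnyCandidate P)
anyCandidate? P? = (P? T1a ⊎-dec P? T1b) ⊎-dec (P? T2a ⊎-dec P? T2b ⊎-dec P? T2c)

anyCandidate-map : ∀ {P Q : Pred (List Point) 0ℓ} → (∀ T → P T → Q T) →
                   AnyCandidate P → AnyCandidate Q
anyCandidate-map f = Sum.map (Sum.map (f _) (f _)) (Sum.map (f _) (Sum.map (f _) (f _)))

decide-sparse : ∀ T → {True (sparse? T)} → Sparse T
decide-sparse T {s} = toWitness s

candidate-sparse : ∀ {P : Pred (List Point) 0ℓ} → AnyCandidate P → ∃[ T ] Sparse T × P T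
candidate-sparse (inj₁ (inj₁ h))        = T1a , decide-sparse T1a , h
candidate-sparse (inj₁ (inj₂ h))        = T1b , decide-sparse T1b , h
candidate-sparse (inj₂ (inj₁ h))        = T2a , decide-sparse T2a , h
candidate-sparse (inj₂ (inj₂ (inj₁ h))) = T2b , decide-sparse T2b , h
candidate-sparse (inj₂ (inj₂ (inj₂ h))) = T2c , decide-sparse T2c , h

sparseTriple-classification : ∀ p₁ p₂ p₃ → let L = p₁ ∷ p₂ ∷ p₃ ∷ [] in
                              Unique L → Sparse L → AnyCandidate (SameElements L)
sparseTriple-classification = toWitness {a? = decision} tt
  where
  decision = ∀-Point? λ p₁ → ∀-Point? λ p₂ → ∀-Point? λ p₃ → let L = p₁ ∷ p₂ ∷ p₃ ∷ [] in
             unique? L →-dec sparse? L →-dec anyCandidate? (λ T → (L ⊆? T) ×-dec (T ⊆? L))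

lemma4p3 : (c : Coloring (Fin 4)) → UsesAllColors c →
    (RainbowFree c × Minimal c) ⇔ (InS1 c ⊎ InS2 c)
lemma4p3 c usesAll = mk⇔ forward backward
  where
  forward : RainbowFree c × Minimal c → InS1 c ⊎ InS2 c
  forward (rainbowFree , d , dom) with nonDominantSet-enumeration dom usesAll
  ... | p , unique , nonDom =
    anyCandidate-map {P = SameElements (tabulate p)} {Q = MinimalWithNonDom c}
      (λ _ sameElements → d , dom , nonDominantSetIs-resp-sameElements nonDom sameElements)
      (sparseTriple-classification (p i1) (p i2) (p i3) unique
        (rainbowFree⇒sparse _≟ᶠ_ nonDom dom rainbowFree))

  backward : InS1 c ⊎ InS2 c → RainbowFree c × Minimal c
  backward h with candidate-sparse {P = MinimalWithNonDom c} h
  ... | _ , sparse , d , dom , nonDom = sparse⇒rainbowFree _≟ᶠ_ nonDom sparse , d , dom
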